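{- Let $S=(\mathtt v_1,\dots,\mathtt v_m)\in(\mathbb R^n)^m$ and let $A$ be a combinatorial graph which is not allowable, i.e. some vertex of $A$ equals $-2e_i$ or $-3e_i+e_j$ ($i\ne j$). Then $A$ has no realization $x\in\mathbb R^n\setminus\{\mathtt v_1,\dots,\mathtt v_m\}$.
   Context: Let $e_1,\dots,e_m$ be the standard basis of $\mathbb Z^m$, $\eta(a)=\sum_ia_i$. $G_2$ is the group of pairs $(a,\sigma)$, $a\in\mathbb Z^m$, $\sigma\in\{\pm1\}$, $\eta(a)=\sigma-1$, with product $(b,\rho)(a,\sigma)=(b+\rho a,\rho\sigma)$ and identity $0=(0,1)$; identify $(a,\sigma)$ with $a$ (so $-2e_i$ and $-3e_i+e_j$ are red, $\sigma=-1$). $X=\{(e_i-e_j,1):i\ne j\}\cup\{(-e_i-e_j,-1):i\ne j\}$; the Cayley graph joins $g$ and $\ell g$. A combinatorial graph is a finite connected subset $A\subset G_2$ containing $0$ with all Cayley edges between its elements. $\pi(a)=\sum_ia_i\mathtt v_i$, $K(a,\sigma)=\frac\sigma2(|\pi(a)|^2+\sum_ia_i|\mathtt v_i|^2)$; $x\in\mathbb R^n$ is a realization of $A$ if for each vertex $(a,\sigma)$ of $A$: $(x,\pi(a))=K(a,\sigma)$ if $\sigma=1$ and $|x|^2+(x,\pi(a))=K(a,\sigma)$ if $\sigma=-1$. -}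

module Defs where

open import Level using (0ℓ)
open import Data.Nat using (ℕ)
open import Data.Integer as ℤ using (ℤ; +_; -[1+_]; 0ℤ; 1ℤ)
open import Data.Fin as Fin using (Fin)
open import Data.Nat as ℕ using ()
open import Relation.Nullary using (yes; no)
open import Data.Vec as Vec using (Vec; []; _∷_; zipWith; lookup; replicate; tabulate)
open import Data.List using (List)
open import Data.List.Membership.Propositional using (_∈_)
open import Data.Product using (Σ; ∃; ∃-syntax; _×_; _,_)
open import Data.Sum using (_⊎_)
open import Relation.Nullary using (¬_)
open import Relation.Binary.PropositionalEquality using (_≡_; _≢_)
open import Relation.Binary using (Rel; IsTotalOrder)
open import Algebra.Structures using (IsCommutativeRing)

-- The real numbers, axiomatised as a complete ordered field
-- (unique up to isomorphism, so quantifying over all such records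
-- is the same as speaking about ℝ).

record RealField : Set₁ where
  infixl 6 _+_
  infixl 7 _*_
  field
    Carrier : Set
    _+_ _*_ : Carrier → Carrier → Carrier
    -_      : Carrier → Carrier
    0# 1#   : Carrier
    isCommutativeRing : IsCommutativeRing _≡_ _+_ _*_ -_ 0# 1#
    0≢1     : 0# ≢ 1#
    two≢0   : (1# + 1#) ≢ 0#   -- redundant (follows from the rest), true in ℝ
    inv     : (x : Carrier) → x ≢ 0# → Carrier
    inverse : ∀ x (p : x ≢ 0#) → x * inv x p ≡ 1#
    _≤_     : Rel Carrier 0ℓ
    isTotalOrder : IsTotalOrder _≡_ _≤_
    +-mono-≤  : ∀ {x y} z → x ≤ y → (x + z) ≤ (y + z)
    *-nonneg  : ∀ {x y} → 0# ≤ x → 0# ≤ y → 0# ≤ (x * y)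
    supremum : (P : Carrier → Set) → ∃ P → (∃[ b ] (∀ y → P y → y ≤ b)) →
               ∃[ s ] ((∀ y → P y → y ≤ s) ×
                       (∀ b → (∀ y → P y → y ≤ b) → s ≤ b))

data Sign : Set where
  pos neg : Sign     -- σ = +1 , σ = -1 (red)

signℤ : Sign → ℤ
signℤ pos = 1ℤ
signℤ neg = ℤ.- 1ℤ

_·s_ : Sign → Sign → Sign
pos ·s σ = σ
neg ·s pos = neg
neg ·s neg = pos

Elem : ℕ → Set
Elem m = Vec ℤ m × Sign

η : ∀ {m} → Vec ℤ m → ℤ
η = Vec.foldr _ ℤ._+_ 0ℤ

InG₂ : ∀ {m} → Elem m → Set
InG₂ (a , σ) = η a ≡ signℤ σ ℤ.- 1ℤ

𝟘 : ∀ {m} → Elem m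
𝟘 = replicate _ 0ℤ , pos

_⊙_ : ∀ {m} → Elem m → Elem m → Elem m
(b , ρ) ⊙ (a , σ) = zipWith ℤ._+_ b (Vec.map (signℤ ρ ℤ.*_) a) , (ρ ·s σ)

e : ∀ {m} → Fin m → Vec ℤ m
e i = tabulate λ k → indicator k
  where
    indicator : Fin _ → ℤ
    indicator k with i Fin.≟ k
    ... | yes _ = 1ℤ
    ... | no _  = 0ℤ

_+v_ : ∀ {m} → Vec ℤ m → Vec ℤ m → Vec ℤ m
_+v_ = zipWith ℤ._+_

_∙v_ : ∀ {m} → ℤ → Vec ℤ m → Vec ℤ m
c ∙v a = Vec.map (c ℤ.*_) a

IsGenerator : ∀ {m} → Elem m → Set
IsGenerator {m} ℓ =
  Σ (Fin m) λ i → Σ (Fin m) λ j → i ≢ j ×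
    ((ℓ ≡ (e i +v ((ℤ.- 1ℤ) ∙v e j) , pos)) ⊎
     (ℓ ≡ (((ℤ.- 1ℤ) ∙v e i) +v ((ℤ.- 1ℤ) ∙v e j) , neg)))

Edge : ∀ {m} → Elem m → Elem m → Set
Edge g h = Σ _ λ ℓ → IsGenerator ℓ × h ≡ ℓ ⊙ g

data PathIn {m} (A : List (Elem m)) : Elem m → Elem m → Set where
  here : ∀ {g} → PathIn A g g
  step : ∀ {g h k} → PathIn A g h → h ∈ A → k ∈ A → Edge h k → PathIn A g k

record CombinatorialGraph (m : ℕ) : Set where
  field
    verts     : List (Elem m)
    inG₂      : ∀ {g} → g ∈ verts → InG₂ g
    has𝟘      : 𝟘 ∈ verts
    connected : ∀ {g} → g ∈ verts → PathIn verts 𝟘 g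

NotAllowable : ∀ {m} → CombinatorialGraph m → Set
NotAllowable {m} A =
  Σ (Elem m) λ g → g ∈ CombinatorialGraph.verts A ×
   ((Σ (Fin m) λ i → g ≡ ((ℤ.- (+ 2)) ∙v e i , neg)) ⊎
    (Σ (Fin m) λ i → Σ (Fin m) λ j → i ≢ j ×
       g ≡ (((ℤ.- (+ 3)) ∙v e i) +v e j , neg)))

module Geometry (R : RealField) where
  open RealField R

  ℝⁿ : ℕ → Set
  ℝⁿ n = Vec Carrier n

  fromℤ : ℤ → Carrier
  fromℕ : ℕ → Carrier
  fromℕ ℕ.zero = 0#
  fromℕ (ℕ.suc k) = 1# + fromℕ k
  fromℤ (+ k) = fromℕ k
  fromℤ -[1+ k ] = - (1# + fromℕ k)

  ⟪_,_⟫ : ∀ {n} → ℝⁿ n → ℝⁿ n → Carrier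
  ⟪ x , y ⟫ = Vec.foldr _ _+_ 0# (zipWith _*_ x y)

  ∣_∣² : ∀ {n} → ℝⁿ n → Carrier
  ∣ x ∣² = ⟪ x , x ⟫

  half : Carrier
  half = inv (1# + 1#) two≢0

  _*v_ : ∀ {n} → Carrier → ℝⁿ n → ℝⁿ n
  c *v x = Vec.map (c *_) x

  _⊕_ : ∀ {n} → ℝⁿ n → ℝⁿ n → ℝⁿ n
  _⊕_ = zipWith _+_

  𝟎 : ∀ {n} → ℝⁿ n
  𝟎 = replicate _ 0#

  module Config {m n : ℕ} (v : Vec (ℝⁿ n) m) where

    π : Vec ℤ m → ℝⁿ n
    π a = Vec.foldr _ _⊕_ 𝟎 (zipWith (λ c w → fromℤ c *v w) a v)

    K : Elem m → Carrier
    K (a , σ) = fromℤ (signℤ σ) * half *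
                (∣ π a ∣² + Vec.foldr _ _+_ 0# (zipWith (λ c w → fromℤ c * ∣ w ∣²) a v))

    VertexCondition : ℝⁿ n → Elem m → Set
    VertexCondition x (a , pos) = ⟪ x , π a ⟫ ≡ K (a , pos)
    VertexCondition x (a , neg) = ∣ x ∣² + ⟪ x , π a ⟫ ≡ K (a , neg)

    IsRealization : CombinatorialGraph m → ℝⁿ n → Set
    IsRealization A x = ∀ {g} → g ∈ CombinatorialGraph.verts A → VertexCondition x g

module Submission where

open import Defs
open import Data.Nat using (ℕ)
open import Data.Fin using (Fin)
open import Data.Vec using (Vec; lookup)
open import Relation.Nullary using (¬_)
open import Relation.Binary.PropositionalEquality using (_≢_)
open import Data.Product using (Σ; _×_)

open import Level using (0ℓ)
open import Function using (_∘_; _∋_)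
open import Data.Product using (_,_)
open import Data.Sum using (inj₁; inj₂)
open import Data.Empty using (⊥-elim)
open import Data.Nat as ℕ using (zero; suc)
open import Data.Nat.Properties using (+-suc)
open import Data.Fin as Fin using (zero; suc)
open import Data.Fin.Properties using (suc-injective)
open import Data.Integer as ℤ using (ℤ; -[1+_]; 0ℤ; 1ℤ)
open import Data.Integer.Properties using ([1+m]⊖[1+n]≡m⊖n)
import Data.Sign as Sign
import Data.Maybe as Maybe
open import Data.Vec as Vec using ([]; _∷_; zipWith)
open import Data.Vec.Properties
  using (lookup∘tabulate; lookup-map; lookup-zipWith; map-cong; map-const;
         zipWith-identityˡ; zipWith-comm; ∷-injectiveˡ; ∷-injectiveʳ)
open import Relation.Nullary using (yes; no)
open import Relation.Binary.Definitions using (WeaklyDecidable)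
open import Relation.Binary.Consequences using (dec⇒weaklyDec)
open import Relation.Binary.Structures using (IsTotalOrder)
open import Relation.Binary.PropositionalEquality
  using (_≡_; refl; sym; trans; cong; cong₂; subst; subst₂; module ≡-Reasoning)
open import Algebra.Bundles using (CommutativeRing)
import Algebra.Properties.Ring as RingProperties
import Algebra.Properties.Group as GroupProperties
open import Algebra.Solver.Ring.AlmostCommutativeRing
  using (_-Raw-AlmostCommutative⟶_; Induced-equivalence; fromCommutativeRing)

-- For a red vertex (a , -1) the realization equation |x|² + (x, π a) = -½ (|π a|² + Σ aᵢ|vᵢ|²)
-- says that the residual 2|x|² + 2(x, π a) + |π a|² + Σ aᵢ|vᵢ|² vanishes.  For a = -2eᵢ the
-- residual equals 2|x - vᵢ|², and for a = -3eᵢ + eⱼ twice the residual equals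
-- 3|x - vᵢ|² + |x - 3vᵢ + 2vⱼ|².  In both cases a vanishing sum of squares forces x = vᵢ.

module IntegerRingSolver (R : RealField) where
  open RealField R
  open Geometry R using (fromℕ; fromℤ)
  open ≡-Reasoning

  commutativeRing : CommutativeRing 0ℓ 0ℓ
  commutativeRing = record { isCommutativeRing = isCommutativeRing }

  open CommutativeRing commutativeRing
    using (+-identityˡ; +-identityʳ; +-comm; +-assoc; *-identityˡ; zeroˡ; distribʳ; -‿inverseʳ; ring)
  open RingProperties ring
    using (-0#≈0#; -‿involutive; -‿anti-homo-+; -‿+-comm; -‿distribˡ-*; -‿distribʳ-*)

  fromℕ-homo-+ : ∀ k l → fromℕ (k ℕ.+ l) ≡ fromℕ k + fromℕ l
  fromℕ-homo-+ zero    l = sym (+-identityˡ _)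
  fromℕ-homo-+ (suc k) l = trans (cong (1# +_) (fromℕ-homo-+ k l)) (sym (+-assoc _ _ _))

  fromℕ-homo-* : ∀ k l → fromℕ (k ℕ.* l) ≡ fromℕ k * fromℕ l
  fromℕ-homo-* zero    l = sym (zeroˡ _)
  fromℕ-homo-* (suc k) l = begin
    fromℕ (l ℕ.+ k ℕ.* l)            ≡⟨ fromℕ-homo-+ l (k ℕ.* l) ⟩
    fromℕ l + fromℕ (k ℕ.* l)        ≡⟨ cong₂ _+_ (sym (*-identityˡ _)) (fromℕ-homo-* k l) ⟩
    1# * fromℕ l + fromℕ k * fromℕ l ≡⟨ distribʳ _ _ _ ⟨
    (1# + fromℕ k) * fromℕ l         ∎

  fromℤ-homo-⊖ : ∀ k l → fromℤ (k ℤ.⊖ l) ≡ fromℕ k + - fromℕ l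
  fromℤ-homo-⊖ zero    zero    = sym (trans (+-identityˡ _) -0#≈0#)
  fromℤ-homo-⊖ (suc k) zero    = sym (trans (cong (fromℕ (suc k) +_) -0#≈0#) (+-identityʳ _))
  fromℤ-homo-⊖ zero    (suc l) = sym (+-identityˡ _)
  fromℤ-homo-⊖ (suc k) (suc l) = begin
    fromℤ (suc k ℤ.⊖ suc l)           ≡⟨ cong fromℤ ([1+m]⊖[1+n]≡m⊖n k l) ⟩
    fromℤ (k ℤ.⊖ l)                   ≡⟨ fromℤ-homo-⊖ k l ⟩
    fromℕ k + - fromℕ l               ≡⟨ cancel 1# (fromℕ k) (fromℕ l) ⟨
    (1# + fromℕ k) + - (1# + fromℕ l) ∎
    where
    cancel : ∀ o a b → (o + a) + - (o + b) ≡ a + - b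
    cancel o a b = begin
      (o + a) + - (o + b)   ≡⟨ cong₂ _+_ (+-comm o a) (trans (-‿anti-homo-+ o b) (+-comm _ _)) ⟩
      (a + o) + (- o + - b) ≡⟨ +-assoc a o _ ⟩
      a + (o + (- o + - b)) ≡⟨ cong (a +_) (+-assoc o (- o) _) ⟨
      a + ((o + - o) + - b) ≡⟨ cong (λ t → a + (t + - b)) (-‿inverseʳ o) ⟩
      a + (0# + - b)        ≡⟨ cong (a +_) (+-identityˡ _) ⟩
      a + - b               ∎

  fromℤ-homo-+ : ∀ i j → fromℤ (i ℤ.+ j) ≡ fromℤ i + fromℤ j
  fromℤ-homo-+ (ℤ.+ k)  (ℤ.+ l)  = fromℕ-homo-+ k l
  fromℤ-homo-+ (ℤ.+ k)  -[1+ l ] = fromℤ-homo-⊖ k (suc l)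
  fromℤ-homo-+ -[1+ k ] (ℤ.+ l)  = trans (fromℤ-homo-⊖ l (suc k)) (+-comm _ _)
  fromℤ-homo-+ -[1+ k ] -[1+ l ] = begin
    - fromℕ (suc (suc (k ℕ.+ l)))     ≡⟨ cong (λ t → - fromℕ (suc t)) (+-suc k l) ⟨
    - fromℕ (suc k ℕ.+ suc l)         ≡⟨ cong -_ (fromℕ-homo-+ (suc k) (suc l)) ⟩
    - (fromℕ (suc k) + fromℕ (suc l)) ≡⟨ -‿+-comm _ _ ⟨
    - fromℕ (suc k) + - fromℕ (suc l) ∎

  fromℤ-homo-neg : ∀ i → fromℤ (ℤ.- i) ≡ - fromℤ i
  fromℤ-homo-neg (ℤ.+ zero)  = sym -0#≈0#
  fromℤ-homo-neg (ℤ.+ suc k) = refl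
  fromℤ-homo-neg -[1+ k ]    = sym (-‿involutive _)

  fromℤ-+◃ : ∀ k → fromℤ (Sign.+ ℤ.◃ k) ≡ fromℕ k
  fromℤ-+◃ zero    = refl
  fromℤ-+◃ (suc k) = refl

  fromℤ--◃ : ∀ k → fromℤ (Sign.- ℤ.◃ k) ≡ - fromℕ k
  fromℤ--◃ zero    = sym -0#≈0#
  fromℤ--◃ (suc k) = refl

  fromℤ-homo-* : ∀ i j → fromℤ (i ℤ.* j) ≡ fromℤ i * fromℤ j
  fromℤ-homo-* (ℤ.+ k)  (ℤ.+ l)  = trans (fromℤ-+◃ (k ℕ.* l)) (fromℕ-homo-* k l)
  fromℤ-homo-* (ℤ.+ k)  -[1+ l ] = begin
    fromℤ (Sign.- ℤ.◃ k ℕ.* suc l) ≡⟨ fromℤ--◃ (k ℕ.* suc l) ⟩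
    - fromℕ (k ℕ.* suc l)          ≡⟨ cong -_ (fromℕ-homo-* k (suc l)) ⟩
    - (fromℕ k * fromℕ (suc l))    ≡⟨ -‿distribʳ-* _ _ ⟩
    fromℕ k * - fromℕ (suc l)      ∎
  fromℤ-homo-* -[1+ k ] (ℤ.+ l)  = begin
    fromℤ (Sign.- ℤ.◃ suc k ℕ.* l) ≡⟨ fromℤ--◃ (suc k ℕ.* l) ⟩
    - fromℕ (suc k ℕ.* l)          ≡⟨ cong -_ (fromℕ-homo-* (suc k) l) ⟩
    - (fromℕ (suc k) * fromℕ l)    ≡⟨ -‿distribˡ-* _ _ ⟩
    - fromℕ (suc k) * fromℕ l      ∎
  fromℤ-homo-* -[1+ k ] -[1+ l ] = begin
    fromℕ (suc k ℕ.* suc l)        ≡⟨ fromℕ-homo-* (suc k) (suc l) ⟩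
    a * b                          ≡⟨ -‿involutive _ ⟨
    - (- (a * b))                  ≡⟨ cong -_ (-‿distribʳ-* a b) ⟩
    - (a * - b)                    ≡⟨ -‿distribˡ-* a (- b) ⟩
    - a * - b                      ∎
    where
    a = fromℕ (suc k)
    b = fromℕ (suc l)

  fromℤ-morphism : ℤ.+-*-rawRing -Raw-AlmostCommutative⟶ fromCommutativeRing commutativeRing
  fromℤ-morphism = record
    { ⟦_⟧    = fromℤ
    ; +-homo = fromℤ-homo-+
    ; *-homo = fromℤ-homo-*
    ; -‿homo = fromℤ-homo-neg
    ; 0-homo = refl
    ; 1-homo = +-identityʳ 1#
    }

  private
    _≟ᶜ_ : WeaklyDecidable (Induced-equivalence fromℤ-morphism)
    i ≟ᶜ j = Maybe.map (cong fromℤ) (dec⇒weaklyDec ℤ._≟_ i j)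

  open import Algebra.Solver.Ring ℤ.+-*-rawRing (fromCommutativeRing commutativeRing) fromℤ-morphism _≟ᶜ_
    public using (solve; _:=_; con; _:+_; _:*_; :-_)

module RealFieldProperties (R : RealField) where
  open RealField R
  open Geometry R using (fromℤ; half)
  open IntegerRingSolver R using (commutativeRing; solve; _:=_; con; _:+_; _:*_; :-_)
  open CommutativeRing commutativeRing
    using (+-identityˡ; +-comm; *-identityˡ; *-identityʳ; *-assoc; zeroˡ; distribʳ; -‿inverseʳ)
  open IsTotalOrder isTotalOrder using (total; antisym) renaming (trans to ≤-trans)
  open ≡-Reasoning

  half+half≡1 : half + half ≡ 1#
  half+half≡1 = begin
    half + half             ≡⟨ cong₂ _+_ (*-identityˡ half) (*-identityˡ half) ⟨
    1# * half + 1# * half   ≡⟨ distribʳ half 1# 1# ⟨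
    (1# + 1#) * half        ≡⟨ inverse (1# + 1#) two≢0 ⟩
    1#                      ∎

  +-nonneg : ∀ {a b} → 0# ≤ a → 0# ≤ b → 0# ≤ (a + b)
  +-nonneg {a} {b} 0≤a 0≤b = ≤-trans 0≤b (subst (_≤ (a + b)) (+-identityˡ b) (+-mono-≤ b 0≤a))

  nonneg+nonneg≡0⇒≡0 : ∀ {a b} → 0# ≤ a → 0# ≤ b → a + b ≡ 0# → a ≡ 0#
  nonneg+nonneg≡0⇒≡0 {a} {b} 0≤a 0≤b a+b≡0 = antisym a≤0 0≤a
    where
    a≤0 : a ≤ 0#
    a≤0 = subst₂ _≤_ (+-identityˡ a) (trans (+-comm b a) a+b≡0) (+-mono-≤ a 0≤b)

  square-nonneg : ∀ t → 0# ≤ (t * t)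
  square-nonneg t with total 0# t
  ... | inj₁ 0≤t = *-nonneg 0≤t 0≤t
  ... | inj₂ t≤0 = subst (0# ≤_) (neg*neg t) (*-nonneg 0≤-t 0≤-t)
    where
    0≤-t : 0# ≤ (- t)
    0≤-t = subst₂ _≤_ (-‿inverseʳ t) (+-identityˡ (- t)) (+-mono-≤ (- t) t≤0)
    neg*neg : ∀ s → - s * - s ≡ s * s
    neg*neg = solve 1 (λ s → :- s :* :- s := s :* s) refl

  square≡0⇒¬¬≡0 : ∀ {t} → t * t ≡ 0# → ¬ ¬ t ≡ 0#
  square≡0⇒¬¬≡0 {t} t²≡0 t≢0 = t≢0 (begin
    t              ≡⟨ *-identityʳ t ⟨
    t * 1#         ≡⟨ cong (t *_) (inverse t t≢0) ⟨
    t * (t * t⁻¹)  ≡⟨ *-assoc t t t⁻¹ ⟨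
    (t * t) * t⁻¹  ≡⟨ cong (_* t⁻¹) t²≡0 ⟩
    0# * t⁻¹       ≡⟨ zeroˡ t⁻¹ ⟩
    0#             ∎)
    where
    t⁻¹ = inv t t≢0

  -½-solution⇒residual≡0 : ∀ {T Z} → T ≡ fromℤ -[1+ 0 ] * half * Z → (T + T) + Z ≡ 0#
  -½-solution⇒residual≡0 {Z = Z} refl = begin
    (-½Z + -½Z) + Z          ≡⟨ solve 2 (λ h Z → let -hZ = con -[1+ 0 ] :* h :* Z in
                                           (-hZ :+ -hZ) :+ Z := Z :+ :- ((h :+ h) :* Z)) refl half Z ⟩
    Z + - ((half + half) * Z) ≡⟨ cong (λ h → Z + - (h * Z)) half+half≡1 ⟩
    Z + - (1# * Z)           ≡⟨ cong (λ t → Z + - t) (*-identityˡ Z) ⟩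
    Z + - Z                  ≡⟨ -‿inverseʳ Z ⟩
    0#                       ∎
    where
    -½Z = fromℤ -[1+ 0 ] * half * Z

module SparseSum {B W : Set} (_∙_ : B → B → B) (ε : B)
                 (identityˡ : ∀ b → ε ∙ b ≡ b) (comm : ∀ b c → b ∙ c ≡ c ∙ b)
                 (g : ℤ → W → B) (g-zero : ∀ w → g 0ℤ w ≡ ε) where

  ∑ : ∀ {m} → Vec ℤ m → Vec W m → B
  ∑ a w = Vec.foldr _ _∙_ ε (zipWith g a w)

  identityʳ : ∀ b → b ∙ ε ≡ b
  identityʳ b = trans (comm b ε) (identityˡ b)

  g-vanishing : ∀ {c} w → c ≡ 0ℤ → g c w ≡ ε
  g-vanishing w refl = g-zero w

  ∑-vanishing : ∀ {m} (a : Vec ℤ m) (w : Vec W m) → (∀ k → lookup a k ≡ 0ℤ) → ∑ a w ≡ ε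
  ∑-vanishing []      []      _   = refl
  ∑-vanishing (c ∷ a) (x ∷ w) a≡0 =
    trans (cong₂ _∙_ (g-vanishing x (a≡0 zero)) (∑-vanishing a w (a≡0 ∘ suc))) (identityˡ ε)

  ∑-single : ∀ {m} (a : Vec ℤ m) (w : Vec W m) (i : Fin m) →
             (∀ k → k ≢ i → lookup a k ≡ 0ℤ) → ∑ a w ≡ g (lookup a i) (lookup w i)
  ∑-single (c ∷ a) (x ∷ w) zero    off =
    trans (cong (g c x ∙_) (∑-vanishing a w (λ k → off (suc k) λ ()))) (identityʳ _)
  ∑-single (c ∷ a) (x ∷ w) (suc i) off =
    trans (cong₂ _∙_ (g-vanishing x (off zero λ ()))
                     (∑-single a w i (λ k k≢i → off (suc k) (k≢i ∘ suc-injective))))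
          (identityˡ _)

  ∑-pair : ∀ {m} (a : Vec ℤ m) (w : Vec W m) (i j : Fin m) → i ≢ j →
           (∀ k → k ≢ i → k ≢ j → lookup a k ≡ 0ℤ) →
           ∑ a w ≡ g (lookup a i) (lookup w i) ∙ g (lookup a j) (lookup w j)
  ∑-pair (c ∷ a) (x ∷ w) zero    zero    i≢j off = ⊥-elim (i≢j refl)
  ∑-pair (c ∷ a) (x ∷ w) zero    (suc j) i≢j off =
    cong (g c x ∙_) (∑-single a w j (λ k k≢j → off (suc k) (λ ()) (k≢j ∘ suc-injective)))
  ∑-pair (c ∷ a) (x ∷ w) (suc i) zero    i≢j off =
    trans (cong (g c x ∙_) (∑-single a w i (λ k k≢i → off (suc k) (k≢i ∘ suc-injective) (λ ()))))
          (comm _ _)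
  ∑-pair (c ∷ a) (x ∷ w) (suc i) (suc j) i≢j off =
    trans (cong₂ _∙_ (g-vanishing x (off zero (λ ()) (λ ())))
                     (∑-pair a w i j (i≢j ∘ cong suc)
                        (λ k k≢i k≢j → off (suc k) (k≢i ∘ suc-injective) (k≢j ∘ suc-injective))))
          (identityˡ _)

-- Abstracting over i ≟ k also rewrites the decision hidden in the tabulated indicator of e i.
lookup-e-self : ∀ {m} (i : Fin m) → lookup (e i) i ≡ 1ℤ
lookup-e-self i with i Fin.≟ i | (lookup (e i) i ≡ _) ∋ lookup∘tabulate _ i
... | yes _   | eᵢᵢ≡1 = eᵢᵢ≡1
... | no  i≢i | _     = ⊥-elim (i≢i refl)

lookup-e-other : ∀ {m} {i k : Fin m} → k ≢ i → lookup (e i) k ≡ 0ℤ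
lookup-e-other {i = i} {k} k≢i with i Fin.≟ k | (lookup (e i) k ≡ _) ∋ lookup∘tabulate _ k
... | yes i≡k | _     = ⊥-elim (k≢i (sym i≡k))
... | no  _   | eᵢₖ≡0 = eᵢₖ≡0

−2e : ∀ {m} → Fin m → Vec ℤ m
−2e i = (ℤ.- (ℤ.+ 2)) ∙v e i

−3e+e : ∀ {m} → Fin m → Fin m → Vec ℤ m
−3e+e i j = ((ℤ.- (ℤ.+ 3)) ∙v e i) +v e j

lookup-∙v-e-self : ∀ {m} c (i : Fin m) → lookup (c ∙v e i) i ≡ c ℤ.* 1ℤ
lookup-∙v-e-self c i = trans (lookup-map i (c ℤ.*_) (e i)) (cong (c ℤ.*_) (lookup-e-self i))

lookup-∙v-e-other : ∀ {m} c (i : Fin m) {k} → k ≢ i → lookup (c ∙v e i) k ≡ c ℤ.* 0ℤ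
lookup-∙v-e-other c i {k} k≢i = trans (lookup-map k (c ℤ.*_) (e i)) (cong (c ℤ.*_) (lookup-e-other k≢i))

module _ {m} {i j : Fin m} (i≢j : i ≢ j) where

  lookup-−3e+e-i : lookup (−3e+e i j) i ≡ -[1+ 2 ]
  lookup-−3e+e-i = trans (lookup-zipWith ℤ._+_ i ((ℤ.- (ℤ.+ 3)) ∙v e i) (e j))
    (cong₂ ℤ._+_ (lookup-∙v-e-self (ℤ.- (ℤ.+ 3)) i) (lookup-e-other i≢j))

  lookup-−3e+e-j : lookup (−3e+e i j) j ≡ ℤ.+ 1
  lookup-−3e+e-j = trans (lookup-zipWith ℤ._+_ j ((ℤ.- (ℤ.+ 3)) ∙v e i) (e j))
    (cong₂ ℤ._+_ (lookup-∙v-e-other (ℤ.- (ℤ.+ 3)) i (i≢j ∘ sym)) (lookup-e-self j))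

  lookup-−3e+e-other : ∀ k → k ≢ i → k ≢ j → lookup (−3e+e i j) k ≡ 0ℤ
  lookup-−3e+e-other k k≢i k≢j = trans (lookup-zipWith ℤ._+_ k ((ℤ.- (ℤ.+ 3)) ∙v e i) (e j))
    (cong₂ ℤ._+_ (lookup-∙v-e-other (ℤ.- (ℤ.+ 3)) i k≢i) (lookup-e-other k≢j))

module EuclideanSpace (R : RealField) where
  open RealField R
  open Geometry R
  open IntegerRingSolver R using (commutativeRing; solve; _:=_; con; _:+_; _:*_; :-_)
  open RealFieldProperties R using (+-nonneg; square-nonneg; nonneg+nonneg≡0⇒≡0; square≡0⇒¬¬≡0)
  open CommutativeRing commutativeRing using (+-identityˡ; +-comm; zeroˡ; +-group)
  open GroupProperties +-group using (x∙y⁻¹≈ε⇒x≈y)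
  open IsTotalOrder isTotalOrder using () renaming (refl to ≤-refl)
  open ≡-Reasoning

  infixl 6 _⊖_
  _⊖_ : ∀ {n} → ℝⁿ n → ℝⁿ n → ℝⁿ n
  _⊖_ = zipWith λ a b → a + - b

  ⊕-identityˡ : ∀ {n} (x : ℝⁿ n) → 𝟎 ⊕ x ≡ x
  ⊕-identityˡ = zipWith-identityˡ +-identityˡ

  ⊕-comm : ∀ {n} (x y : ℝⁿ n) → x ⊕ y ≡ y ⊕ x
  ⊕-comm = zipWith-comm +-comm

  0*v≡𝟎 : ∀ {n} (x : ℝⁿ n) → 0# *v x ≡ 𝟎
  0*v≡𝟎 x = trans (map-cong zeroˡ x) (map-const x 0#)

  ∣∣²-nonneg : ∀ {n} (x : ℝⁿ n) → 0# ≤ ∣ x ∣²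
  ∣∣²-nonneg []      = ≤-refl
  ∣∣²-nonneg (a ∷ x) = +-nonneg (square-nonneg a) (∣∣²-nonneg x)

  ∣∣²≡0⇒¬¬≡𝟎 : ∀ {n} {x : ℝⁿ n} → ∣ x ∣² ≡ 0# → ¬ ¬ x ≡ 𝟎
  ∣∣²≡0⇒¬¬≡𝟎 {x = []}    _       []≢𝟎  = []≢𝟎 refl
  ∣∣²≡0⇒¬¬≡𝟎 {x = a ∷ x} ∣a∷x∣²≡0 a∷x≢𝟎 =
    square≡0⇒¬¬≡0 a²≡0 λ a≡0 → ∣∣²≡0⇒¬¬≡𝟎 ∣x∣²≡0 λ x≡𝟎 → a∷x≢𝟎 (cong₂ _∷_ a≡0 x≡𝟎)
    where
    a²≡0 : a * a ≡ 0#
    a²≡0 = nonneg+nonneg≡0⇒≡0 (square-nonneg a) (∣∣²-nonneg x) ∣a∷x∣²≡0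
    ∣x∣²≡0 : ∣ x ∣² ≡ 0#
    ∣x∣²≡0 = nonneg+nonneg≡0⇒≡0 (∣∣²-nonneg x) (square-nonneg a) (trans (+-comm _ _) ∣a∷x∣²≡0)

  ⊖≡𝟎⇒≡ : ∀ {n} {x y : ℝⁿ n} → x ⊖ y ≡ 𝟎 → x ≡ y
  ⊖≡𝟎⇒≡ {x = []}    {[]}    _   = refl
  ⊖≡𝟎⇒≡ {x = a ∷ x} {b ∷ y} eq =
    cong₂ _∷_ (x∙y⁻¹≈ε⇒x≈y a b (∷-injectiveˡ eq)) (⊖≡𝟎⇒≡ (∷-injectiveʳ eq))

  ∣⊖∣²≡0⇒¬¬≡ : ∀ {n} {x y : ℝⁿ n} → ∣ x ⊖ y ∣² ≡ 0# → ¬ ¬ x ≡ y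
  ∣⊖∣²≡0⇒¬¬≡ ∣x⊖y∣²≡0 x≢y = ∣∣²≡0⇒¬¬≡𝟎 ∣x⊖y∣²≡0 (x≢y ∘ ⊖≡𝟎⇒≡)

  -- Twice the red vertex equation ∣x∣² + ⟪x, p⟫ = -½ (∣p∣² + s), with p = π a and s = Σ aᵢ∣vᵢ∣², moved to one side.
  redResidual : ∀ {n} → ℝⁿ n → ℝⁿ n → Carrier → Carrier
  redResidual x p s = (T + T) + (∣ p ∣² + s)
    where
    T = ∣ x ∣² + ⟪ x , p ⟫

  redResidual-−2e : ∀ {n} (x u : ℝⁿ n) →
    redResidual x (fromℤ -[1+ 1 ] *v u) (fromℤ -[1+ 1 ] * ∣ u ∣²) ≡ ∣ x ⊖ u ∣² + ∣ x ⊖ u ∣²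
  redResidual-−2e []      []      = solve 0 (let z = con 0ℤ in
    ((z :+ z) :+ (z :+ z)) :+ (z :+ con -[1+ 1 ] :* z) := z :+ z) refl
  redResidual-−2e (a ∷ x) (b ∷ u) = begin
    redResidual (a ∷ x) (c *v (b ∷ u)) (c * ∣ b ∷ u ∣²)
      ≡⟨ solve 6 (λ a b X P Π U →
           let T = (a :* a :+ X) :+ (a :* (con -[1+ 1 ] :* b) :+ P)
               cb = con -[1+ 1 ] :* b
               y = a :+ :- b
           in (T :+ T) :+ ((cb :* cb :+ Π) :+ con -[1+ 1 ] :* (b :* b :+ U))
              := (y :* y :+ y :* y) :+ (((X :+ P) :+ (X :+ P)) :+ (Π :+ con -[1+ 1 ] :* U)))
           refl a b ∣ x ∣² ⟪ x , c *v u ⟫ ∣ c *v u ∣² ∣ u ∣² ⟩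
    δ + redResidual x (c *v u) (c * ∣ u ∣²)
      ≡⟨ cong (δ +_) (redResidual-−2e x u) ⟩
    δ + (∣ x ⊖ u ∣² + ∣ x ⊖ u ∣²)
      ≡⟨ solve 3 (λ a b D → let y = a :+ :- b in
           (y :* y :+ y :* y) :+ (D :+ D) := (y :* y :+ D) :+ (y :* y :+ D)) refl a b ∣ x ⊖ u ∣² ⟩
    ∣ (a ∷ x) ⊖ (b ∷ u) ∣² + ∣ (a ∷ x) ⊖ (b ∷ u) ∣²
      ∎
    where
    c = fromℤ -[1+ 1 ]
    δ = (a + - b) * (a + - b) + (a + - b) * (a + - b)

  redResidual-−3e+e : ∀ {n} (x u w : ℝⁿ n) →
    let p = (fromℤ -[1+ 2 ] *v u) ⊕ (fromℤ (ℤ.+ 1) *v w)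
        s = fromℤ -[1+ 2 ] * ∣ u ∣² + fromℤ (ℤ.+ 1) * ∣ w ∣²
    in redResidual x p s + redResidual x p s
       ≡ ∣ x ⊖ u ∣² + (∣ x ⊖ u ∣² + (∣ x ⊖ u ∣² + ∣ (x ⊖ u) ⊕ ((w ⊖ u) ⊕ (w ⊖ u)) ∣²))
  redResidual-−3e+e []      []      []      = solve 0
    (let z = con 0ℤ
         r = ((z :+ z) :+ (z :+ z)) :+ (z :+ (con -[1+ 2 ] :* z :+ con (ℤ.+ 1) :* z))
     in r :+ r := z :+ (z :+ (z :+ z)))
    refl
  redResidual-−3e+e (a ∷ x) (b ∷ u) (c ∷ w) = begin
    residual (a ∷ x) (b ∷ u) (c ∷ w) + residual (a ∷ x) (b ∷ u) (c ∷ w)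
      ≡⟨ solve 8 (λ a b c X P Π U W →
           let p = con -[1+ 2 ] :* b :+ con (ℤ.+ 1) :* c
               T = (a :* a :+ X) :+ (a :* p :+ P)
               r = (T :+ T) :+ ((p :* p :+ Π) :+ (con -[1+ 2 ] :* (b :* b :+ U) :+ con (ℤ.+ 1) :* (c :* c :+ W)))
               r₀ = ((X :+ P) :+ (X :+ P)) :+ (Π :+ (con -[1+ 2 ] :* U :+ con (ℤ.+ 1) :* W))
               y = a :+ :- b
               q = y :+ ((c :+ :- b) :+ (c :+ :- b))
           in r :+ r := (y :* y :+ (y :* y :+ (y :* y :+ q :* q))) :+ (r₀ :+ r₀))
           refl a b c ∣ x ∣² ⟪ x , p₀ ⟫ ∣ p₀ ∣² ∣ u ∣² ∣ w ∣² ⟩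
    δ + (residual x u w + residual x u w)
      ≡⟨ cong (δ +_) (redResidual-−3e+e x u w) ⟩
    δ + (∣ x ⊖ u ∣² + (∣ x ⊖ u ∣² + (∣ x ⊖ u ∣² + ∣ (x ⊖ u) ⊕ ((w ⊖ u) ⊕ (w ⊖ u)) ∣²)))
      ≡⟨ solve 5 (λ a b c D Q →
           let y = a :+ :- b
               q = y :+ ((c :+ :- b) :+ (c :+ :- b))
           in (y :* y :+ (y :* y :+ (y :* y :+ q :* q))) :+ (D :+ (D :+ (D :+ Q)))
              := (y :* y :+ D) :+ ((y :* y :+ D) :+ ((y :* y :+ D) :+ (q :* q :+ Q))))
           refl a b c ∣ x ⊖ u ∣² ∣ (x ⊖ u) ⊕ ((w ⊖ u) ⊕ (w ⊖ u)) ∣² ⟩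
    ∣ (a ∷ x) ⊖ (b ∷ u) ∣² + (∣ (a ∷ x) ⊖ (b ∷ u) ∣² + (∣ (a ∷ x) ⊖ (b ∷ u) ∣² +
      ∣ ((a ∷ x) ⊖ (b ∷ u)) ⊕ (((c ∷ w) ⊖ (b ∷ u)) ⊕ ((c ∷ w) ⊖ (b ∷ u))) ∣²))
      ∎
    where
    residual : ∀ {k} → ℝⁿ k → ℝⁿ k → ℝⁿ k → Carrier
    residual x′ u′ w′ = redResidual x′ ((fromℤ -[1+ 2 ] *v u′) ⊕ (fromℤ (ℤ.+ 1) *v w′))
                                      (fromℤ -[1+ 2 ] * ∣ u′ ∣² + fromℤ (ℤ.+ 1) * ∣ w′ ∣²)
    p₀ = (fromℤ -[1+ 2 ] *v u) ⊕ (fromℤ (ℤ.+ 1) *v w)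
    y = a + - b
    q = y + ((c + - b) + (c + - b))
    δ = y * y + (y * y + (y * y + q * q))

module Realization (R : RealField) {m n : ℕ} (v : Vec (Geometry.ℝⁿ R n) m) where
  open RealField R
  open Geometry R
  open Config v
  open IntegerRingSolver R using (commutativeRing)
  open CommutativeRing commutativeRing using (+-identityˡ; +-comm; zeroˡ)
  open RealFieldProperties R using (+-nonneg; nonneg+nonneg≡0⇒≡0; -½-solution⇒residual≡0)
  open EuclideanSpace R

  weightedNorms : Vec ℤ m → Carrier
  weightedNorms a = Vec.foldr _ _+_ 0# (zipWith (λ c w → fromℤ c * ∣ w ∣²) a v)

  private
    module πSum = SparseSum {ℝⁿ n} {ℝⁿ n} _⊕_ 𝟎 ⊕-identityˡ ⊕-comm (λ c w → fromℤ c *v w) 0*v≡𝟎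
    module NormSum = SparseSum {Carrier} {ℝⁿ n} _+_ 0# +-identityˡ +-comm (λ c w → fromℤ c * ∣ w ∣²) (λ w → zeroˡ ∣ w ∣²)

  red-condition⇒residual≡0 : ∀ x a → VertexCondition x (a , neg) →
                             redResidual x (π a) (weightedNorms a) ≡ 0#
  red-condition⇒residual≡0 x a = -½-solution⇒residual≡0

  π-−2e : ∀ i → π (−2e i) ≡ fromℤ -[1+ 1 ] *v lookup v i
  π-−2e i = trans (πSum.∑-single (−2e i) v i (λ _ → lookup-∙v-e-other (ℤ.- (ℤ.+ 2)) i))
                  (cong (λ c → fromℤ c *v lookup v i) (lookup-∙v-e-self (ℤ.- (ℤ.+ 2)) i))

  weightedNorms-−2e : ∀ i → weightedNorms (−2e i) ≡ fromℤ -[1+ 1 ] * ∣ lookup v i ∣²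
  weightedNorms-−2e i = trans (NormSum.∑-single (−2e i) v i (λ _ → lookup-∙v-e-other (ℤ.- (ℤ.+ 2)) i))
                              (cong (λ c → fromℤ c * ∣ lookup v i ∣²) (lookup-∙v-e-self (ℤ.- (ℤ.+ 2)) i))

  π-−3e+e : ∀ {i j} → i ≢ j →
            π (−3e+e i j) ≡ (fromℤ -[1+ 2 ] *v lookup v i) ⊕ (fromℤ (ℤ.+ 1) *v lookup v j)
  π-−3e+e {i} {j} i≢j =
    trans (πSum.∑-pair (−3e+e i j) v i j i≢j (lookup-−3e+e-other i≢j))
          (cong₂ (λ c d → (fromℤ c *v lookup v i) ⊕ (fromℤ d *v lookup v j))
                 (lookup-−3e+e-i i≢j) (lookup-−3e+e-j i≢j))

  weightedNorms-−3e+e : ∀ {i j} → i ≢ j →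
    weightedNorms (−3e+e i j) ≡ fromℤ -[1+ 2 ] * ∣ lookup v i ∣² + fromℤ (ℤ.+ 1) * ∣ lookup v j ∣²
  weightedNorms-−3e+e {i} {j} i≢j =
    trans (NormSum.∑-pair (−3e+e i j) v i j i≢j (lookup-−3e+e-other i≢j))
          (cong₂ (λ c d → fromℤ c * ∣ lookup v i ∣² + fromℤ d * ∣ lookup v j ∣²)
                 (lookup-−3e+e-i i≢j) (lookup-−3e+e-j i≢j))

  ¬realizes-−2e : ∀ i {x} → x ≢ lookup v i → ¬ VertexCondition x (−2e i , neg)
  ¬realizes-−2e i {x} x≢vᵢ condition = ∣⊖∣²≡0⇒¬¬≡ ∣x⊖vᵢ∣²≡0 x≢vᵢ
    where
    vᵢ = lookup v i
    residual≡0 : redResidual x (fromℤ -[1+ 1 ] *v vᵢ) (fromℤ -[1+ 1 ] * ∣ vᵢ ∣²) ≡ 0#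
    residual≡0 = subst₂ (λ p s → redResidual x p s ≡ 0#) (π-−2e i) (weightedNorms-−2e i)
                        (red-condition⇒residual≡0 x (−2e i) condition)
    ∣x⊖vᵢ∣²≡0 : ∣ x ⊖ vᵢ ∣² ≡ 0#
    ∣x⊖vᵢ∣²≡0 = nonneg+nonneg≡0⇒≡0 (∣∣²-nonneg (x ⊖ vᵢ)) (∣∣²-nonneg (x ⊖ vᵢ))
                  (trans (sym (redResidual-−2e x vᵢ)) residual≡0)

  ¬realizes-−3e+e : ∀ {i j} → i ≢ j → ∀ {x} → x ≢ lookup v i → ¬ VertexCondition x (−3e+e i j , neg)
  ¬realizes-−3e+e {i} {j} i≢j {x} x≢vᵢ condition = ∣⊖∣²≡0⇒¬¬≡ ∣x⊖vᵢ∣²≡0 x≢vᵢ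
    where
    vᵢ = lookup v i
    vⱼ = lookup v j
    residual≡0 : redResidual x ((fromℤ -[1+ 2 ] *v vᵢ) ⊕ (fromℤ (ℤ.+ 1) *v vⱼ))
                               (fromℤ -[1+ 2 ] * ∣ vᵢ ∣² + fromℤ (ℤ.+ 1) * ∣ vⱼ ∣²) ≡ 0#
    residual≡0 = subst₂ (λ p s → redResidual x p s ≡ 0#) (π-−3e+e i≢j) (weightedNorms-−3e+e i≢j)
                        (red-condition⇒residual≡0 x (−3e+e i j) condition)
    ∣x⊖vᵢ∣²≡0 : ∣ x ⊖ vᵢ ∣² ≡ 0#
    ∣x⊖vᵢ∣²≡0 = nonneg+nonneg≡0⇒≡0 (∣∣²-nonneg (x ⊖ vᵢ))
                  (+-nonneg (∣∣²-nonneg (x ⊖ vᵢ))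
                            (+-nonneg (∣∣²-nonneg (x ⊖ vᵢ))
                                      (∣∣²-nonneg ((x ⊖ vᵢ) ⊕ ((vⱼ ⊖ vᵢ) ⊕ (vⱼ ⊖ vᵢ))))))
                  (trans (sym (redResidual-−3e+e x vᵢ vⱼ))
                         (trans (cong₂ _+_ residual≡0 residual≡0) (+-identityˡ 0#)))

  noRealization : (A : CombinatorialGraph m) → NotAllowable A →
                  ¬ Σ (ℝⁿ n) (λ x → ((i : Fin m) → x ≢ lookup v i) × IsRealization A x)
  noRealization A (_ , g∈A , inj₁ (i , refl)) (x , x∉v , realizes) =
    ¬realizes-−2e i (x∉v i) (realizes g∈A)
  noRealization A (_ , g∈A , inj₂ (i , j , i≢j , refl)) (x , x∉v , realizes) =
    ¬realizes-−3e+e i≢j (x∉v i) (realizes g∈A)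

mainTheorem10 : (R : RealField) → (m n : ℕ) →
    (v : Vec (Geometry.ℝⁿ R n) m) → (A : CombinatorialGraph m) →
    NotAllowable A →
    ¬ Σ (Geometry.ℝⁿ R n) (λ x →
        ((i : Fin m) → x ≢ lookup v i) × Geometry.Config.IsRealization R v A x)
mainTheorem10 R m n v = Realization.noRealization R v
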